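{- For an integer $m\ge 3$ let $\sigma_m=(1,2,2,3,4,5,\dots,m-1,m,m+2)$, i.e. the integers $1,\dots,m$ together with an extra $2$ and the number $m+2$. Then $\nu(\sigma_m)=0$ and, as a polynomial identity in $t$, $$\nu(\sigma_m+t)=t\Big(-2(2+t)^2-\tfrac12(t-1)(3+2t)m-\tfrac12(t-1)m^2\Big).$$ In particular $\nu(\sigma_m+1)=-18$ for all $m\ge 5$.
   Context: For a finite sequence $(a_1,\dots,a_N)$ (repetitions allowed), $\nu(a_1,\dots,a_N)=\big(\sum a_i\big)^2-\sum a_i^3$, and $\sigma+t=(a_1+t,\dots,a_N+t)$. -}

module Defs where

open import Data.Nat as ℕ using (ℕ; _∸_)
open import Data.List using (List; _∷_; []; map; foldr; upTo; _++_; [_])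
open import Data.Rational using (ℚ; 0ℚ; _+_; _*_; _-_)
import Data.Rational as ℚ
open import Data.Integer using (+_)

Σℚ : List ℚ → ℚ
Σℚ = foldr _+_ 0ℚ

ν : List ℚ → ℚ
ν as = Σℚ as * Σℚ as - Σℚ (map (λ a → a * a * a) as)

_+ₛ_ : List ℚ → ℚ → List ℚ
σ +ₛ t = map (λ a → a + t) σ

ℚ[_] : ℕ → ℚ
ℚ[ n ] = (+ n) ℚ./ 1

-- σ_m = (1, 2, 2, 3, 4, …, m, m+2)   (intended for m ≥ 3)
σ : ℕ → List ℚ
σ m = ℚ[ 1 ] ∷ ℚ[ 2 ] ∷ ℚ[ 2 ] ∷ map (λ i → ℚ[ 3 ℕ.+ i ]) (upTo (m ∸ 2)) ++ [ ℚ[ m ℕ.+ 2 ] ]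

-- The shifted sequence σ_m + t is 1+t, 2+t, 2+t, then the arithmetic
-- progression 3+t, 4+t, …, m+t, then m+2+t.  Both power sums in ν thus reduce
-- to sums over a progression y, y+1, …, y+n-1, and these telescope: with
-- T x = x(x-1)/2 the terms sum to T(y+n) - T y and their cubes to
-- T(y+n)² - (T y)² (Nicomachus).  What remains is a polynomial identity in t
-- and m, whose values at t = 0 and t = 1 give the other two claims.
module Submission where

open import Defs
open import Data.Nat as ℕ using (ℕ; zero; suc; _≤_; s≤s)
import Data.Nat.Properties as ℕ
open import Data.Integer as ℤ using (+_)
import Data.Integer.Properties as ℤ
import Data.Nat.Coprimality as Coprimality
open import Data.Product using (_×_; _,_)
open import Data.List using (List; _∷_; []; map; upTo; applyUpTo; _++_; [_])
open import Data.List.Properties using (map-++; map-id; map-cong; map-∘; map-upTo)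
open import Data.Rational using (ℚ; 0ℚ; 1ℚ; _+_; _*_; _-_; -_; ½; mkℚ; _/_)
open import Data.Rational.Properties
  using (normalize-coprime; +-assoc; +-identityˡ; +-identityʳ; +-0-commutativeMonoid)
open import Data.Rational.Solver using (module +-*-Solver)
open import Algebra.Bundles using (CommutativeMonoid)
open import Algebra.Properties.CommutativeSemigroup
  (CommutativeMonoid.commutativeSemigroup +-0-commutativeMonoid) using (xy∙z≈xz∙y; x∙yz≈xz∙y)
open import Function using (id; _∘_)
open import Relation.Binary.PropositionalEquality hiding ([_])
open ≡-Reasoning
open +-*-Solver

ℚ[]-suc : ∀ n → ℚ[ suc n ] ≡ ℚ[ n ] + 1ℚ
ℚ[]-suc n = begin
  ℚ[ suc n ]                             ≡⟨ cong (_/ 1) numerator ⟨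
  (+ n ℤ.* + 1 ℤ.+ + 1 ℤ.* + 1) / 1      ≡⟨⟩
  mkℚ (+ n) 0 coprime + 1ℚ               ≡⟨ cong (_+ 1ℚ) (normalize-coprime coprime) ⟨
  ℚ[ n ] + 1ℚ                            ∎
  where
  coprime = Coprimality.sym (Coprimality.1-coprimeTo n)
  numerator : + n ℤ.* + 1 ℤ.+ + 1 ℤ.* + 1 ≡ + suc n
  numerator = trans (cong (ℤ._+ + 1) (ℤ.*-identityʳ (+ n))) (cong +_ (ℕ.+-comm n 1))

ℚ[]-+ : ∀ m n → ℚ[ m ℕ.+ n ] ≡ ℚ[ m ] + ℚ[ n ]
ℚ[]-+ zero    n = sym (+-identityˡ ℚ[ n ])
ℚ[]-+ (suc m) n = begin
  ℚ[ suc (m ℕ.+ n) ]      ≡⟨ ℚ[]-suc (m ℕ.+ n) ⟩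
  ℚ[ m ℕ.+ n ] + 1ℚ       ≡⟨ cong (_+ 1ℚ) (ℚ[]-+ m n) ⟩
  ℚ[ m ] + ℚ[ n ] + 1ℚ    ≡⟨ xy∙z≈xz∙y ℚ[ m ] ℚ[ n ] 1ℚ ⟩
  ℚ[ m ] + 1ℚ + ℚ[ n ]    ≡⟨ cong (_+ ℚ[ n ]) (ℚ[]-suc m) ⟨
  ℚ[ suc m ] + ℚ[ n ]     ∎

cube : ℚ → ℚ
cube a = a * a * a

Σℚ-++ : ∀ xs ys → Σℚ (xs ++ ys) ≡ Σℚ xs + Σℚ ys
Σℚ-++ []       ys = sym (+-identityˡ (Σℚ ys))
Σℚ-++ (x ∷ xs) ys = trans (cong (λ s → x + s) (Σℚ-++ xs ys)) (sym (+-assoc x (Σℚ xs) (Σℚ ys)))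

ν-++ : ∀ xs ys → ν (xs ++ ys) ≡
  (Σℚ xs + Σℚ ys) * (Σℚ xs + Σℚ ys) - (Σℚ (map cube xs) + Σℚ (map cube ys))
ν-++ xs ys = cong₂ (λ s c → s * s - c) (Σℚ-++ xs ys)
  (trans (cong Σℚ (map-++ cube xs ys)) (Σℚ-++ (map cube xs) (map cube ys)))

+ₛ-identityʳ : ∀ xs → xs +ₛ 0ℚ ≡ xs
+ₛ-identityʳ xs = trans (map-cong +-identityʳ xs) (map-id xs)

progression : ℚ → ℕ → List ℚ
progression y zero    = []
progression y (suc n) = y ∷ progression (y + 1ℚ) n

applyUpTo-progression : ∀ (f : ℕ → ℚ) y n → (∀ i → f i ≡ y + ℚ[ i ]) →
  applyUpTo f n ≡ progression y n
applyUpTo-progression f y zero    _    = refl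
applyUpTo-progression f y (suc n) f≗y+ = cong₂ _∷_
  (trans (f≗y+ 0) (+-identityʳ y))
  (applyUpTo-progression (f ∘ suc) (y + 1ℚ) n λ i →
    trans (f≗y+ (suc i)) (trans (cong (λ s → y + s) (ℚ[]-suc i)) (x∙yz≈xz∙y y ℚ[ i ] 1ℚ)))

Σℚ-telescope : ∀ (f F : ℚ → ℚ) → (∀ x → F (x + 1ℚ) - F x ≡ f x) →
  ∀ y n → Σℚ (map f (progression y n)) ≡ F (y + ℚ[ n ]) - F y
Σℚ-telescope f F ΔF≡f y zero = sym (begin
  F (y + 0ℚ) - F y    ≡⟨ cong (λ x → F x - F y) (+-identityʳ y) ⟩
  F y - F y           ≡⟨ solve 1 (λ a → a :- a := con 0ℚ) refl (F y) ⟩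
  0ℚ                  ∎)
Σℚ-telescope f F ΔF≡f y (suc n) = begin
  f y + Σℚ (map f (progression (y + 1ℚ) n))
    ≡⟨ cong₂ _+_ (sym (ΔF≡f y)) (Σℚ-telescope f F ΔF≡f (y + 1ℚ) n) ⟩
  (F (y + 1ℚ) - F y) + (F (y + 1ℚ + ℚ[ n ]) - F (y + 1ℚ))
    ≡⟨ solve 3 (λ a b c → (b :- a) :+ (c :- b) := c :- a) refl (F y) (F (y + 1ℚ)) (F (y + 1ℚ + ℚ[ n ])) ⟩
  F (y + 1ℚ + ℚ[ n ]) - F y
    ≡⟨ cong (λ x → F x - F y) (trans (xy∙z≈xz∙y y 1ℚ ℚ[ n ]) (+-assoc y ℚ[ n ] 1ℚ)) ⟩
  F (y + (ℚ[ n ] + 1ℚ)) - F y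
    ≡⟨ cong (λ x → F (y + x) - F y) (ℚ[]-suc n) ⟨
  F (y + ℚ[ suc n ]) - F y ∎

triangle : ℚ → ℚ
triangle x = ½ * x * (x - 1ℚ)

-- A name with subscript ₚ denotes the same expression in the syntax of the ring solver.
triangleₚ : ∀ {k} → Polynomial k → Polynomial k
triangleₚ x = con ½ :* x :* (x :- con 1ℚ)

Σℚ-progression : ∀ y n → Σℚ (progression y n) ≡ triangle (y + ℚ[ n ]) - triangle y
Σℚ-progression y n = trans (cong Σℚ (sym (map-id (progression y n))))
  (Σℚ-telescope id triangle
    (solve 1 (λ x → triangleₚ (x :+ con 1ℚ) :- triangleₚ x := x) refl) y n)

Σℚ-cubes-progression : ∀ y n → Σℚ (map cube (progression y n)) ≡
  triangle (y + ℚ[ n ]) * triangle (y + ℚ[ n ]) - triangle y * triangle y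
Σℚ-cubes-progression = Σℚ-telescope cube (λ x → triangle x * triangle x)
  (solve 1 (λ x → square (triangleₚ (x :+ con 1ℚ)) :- square (triangleₚ x) := x :* x :* x) refl)
  where
  square : ∀ {k} → Polynomial k → Polynomial k
  square p = p :* p

σ+ₛ-progression : ∀ n t → σ (2 ℕ.+ n) +ₛ t ≡
  (ℚ[ 1 ] + t) ∷ (ℚ[ 2 ] + t) ∷ (ℚ[ 2 ] + t) ∷ progression (ℚ[ 3 ] + t) n ++ [ ℚ[ 4 ] + ℚ[ n ] + t ]
σ+ₛ-progression n t = cong (λ xs → (ℚ[ 1 ] + t) ∷ (ℚ[ 2 ] + t) ∷ (ℚ[ 2 ] + t) ∷ xs) (begin
  map (_+ t) (map middle (upTo n) ++ [ ℚ[ 2 ℕ.+ n ℕ.+ 2 ] ])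
    ≡⟨ map-++ (_+ t) (map middle (upTo n)) _ ⟩
  map (_+ t) (map middle (upTo n)) ++ [ ℚ[ 2 ℕ.+ n ℕ.+ 2 ] + t ]
    ≡⟨ cong₂ (λ xs z → xs ++ [ z + t ]) shifted-middle last ⟩
  progression (ℚ[ 3 ] + t) n ++ [ ℚ[ 4 ] + ℚ[ n ] + t ] ∎)
  where
  middle : ℕ → ℚ
  middle i = ℚ[ 3 ℕ.+ i ]
  shifted-middle : map (_+ t) (map middle (upTo n)) ≡ progression (ℚ[ 3 ] + t) n
  shifted-middle = begin
    map (_+ t) (map middle (upTo n))   ≡⟨ map-∘ (upTo n) ⟨
    map ((_+ t) ∘ middle) (upTo n)     ≡⟨ map-upTo _ n ⟩
    applyUpTo ((_+ t) ∘ middle) n      ≡⟨ applyUpTo-progression _ _ n (λ i →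
                                            trans (cong (_+ t) (ℚ[]-+ 3 i)) (xy∙z≈xz∙y ℚ[ 3 ] ℚ[ i ] t)) ⟩
    progression (ℚ[ 3 ] + t) n         ∎
  last : ℚ[ 2 ℕ.+ n ℕ.+ 2 ] ≡ ℚ[ 4 ] + ℚ[ n ]
  last = trans (cong ℚ[_] (ℕ.+-comm (2 ℕ.+ n) 2)) (ℚ[]-+ 4 n)

closedForm : ℚ → ℚ → ℚ
closedForm t m = t * (- (ℚ[ 2 ] * ((ℚ[ 2 ] + t) * (ℚ[ 2 ] + t)))
  - ½ * (t - ℚ[ 1 ]) * (ℚ[ 3 ] + ℚ[ 2 ] * t) * m - ½ * (t - ℚ[ 1 ]) * (m * m))

closedFormₚ : ∀ {k} → Polynomial k → Polynomial k → Polynomial k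
closedFormₚ t m = t :* (:- (con ℚ[ 2 ] :* ((con ℚ[ 2 ] :+ t) :* (con ℚ[ 2 ] :+ t)))
  :- con ½ :* (t :- con ℚ[ 1 ]) :* (con ℚ[ 3 ] :+ con ℚ[ 2 ] :* t) :* m :- con ½ :* (t :- con ℚ[ 1 ]) :* (m :* m))

closedForm-zero : ∀ m → closedForm 0ℚ m ≡ 0ℚ
closedForm-zero = solve 1 (λ m → closedFormₚ (con 0ℚ) m := con 0ℚ) refl

closedForm-one : ∀ m → closedForm ℚ[ 1 ] m ≡ - ℚ[ 18 ]
closedForm-one = solve 1 (λ m → closedFormₚ (con ℚ[ 1 ]) m := con (- ℚ[ 18 ])) refl

ν-σ+ₛ : ∀ n t → ν (σ (2 ℕ.+ n) +ₛ t) ≡ closedForm t ℚ[ 2 ℕ.+ n ]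
ν-σ+ₛ n t = begin
  ν (σ (2 ℕ.+ n) +ₛ t)
    ≡⟨ cong ν (σ+ₛ-progression n t) ⟩
  ν ((g₁ ∷ g₂ ∷ g₂ ∷ P) ++ [ w ])
    ≡⟨ ν-++ (g₁ ∷ g₂ ∷ g₂ ∷ P) [ w ] ⟩
  νFromSums (Σℚ P) (Σℚ (map cube P))
    ≡⟨ cong₂ νFromSums (Σℚ-progression y n) (Σℚ-cubes-progression y n) ⟩
  νFromSums (triangle (y + N) - triangle y) (triangle (y + N) * triangle (y + N) - triangle y * triangle y)
    ≡⟨ solve 2 (λ t N → νFromSumsₚ t N := closedFormₚ t (con ℚ[ 2 ] :+ N)) refl t N ⟩
  closedForm t (ℚ[ 2 ] + N)
    ≡⟨ cong (closedForm t) (ℚ[]-+ 2 n) ⟨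
  closedForm t ℚ[ 2 ℕ.+ n ] ∎
  where
  N g₁ g₂ y w : ℚ
  N  = ℚ[ n ]
  g₁ = ℚ[ 1 ] + t
  g₂ = ℚ[ 2 ] + t
  y  = ℚ[ 3 ] + t
  w  = ℚ[ 4 ] + N + t
  P : List ℚ
  P = progression y n
  νFromSums : ℚ → ℚ → ℚ
  νFromSums S C = (g₁ + (g₂ + (g₂ + S)) + (w + 0ℚ)) * (g₁ + (g₂ + (g₂ + S)) + (w + 0ℚ))
    - (cube g₁ + (cube g₂ + (cube g₂ + C)) + (cube w + 0ℚ))
  νFromSumsₚ : ∀ {k} → Polynomial k → Polynomial k → Polynomial k
  νFromSumsₚ {k} t N = (G₁ :+ (G₂ :+ (G₂ :+ S)) :+ (W :+ con 0ℚ)) :* (G₁ :+ (G₂ :+ (G₂ :+ S)) :+ (W :+ con 0ℚ))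
    :- (G₁ :* G₁ :* G₁ :+ (G₂ :* G₂ :* G₂ :+ (G₂ :* G₂ :* G₂ :+ C)) :+ (W :* W :* W :+ con 0ℚ))
    where
    G₁ G₂ Y W S C : Polynomial k
    G₁ = con ℚ[ 1 ] :+ t
    G₂ = con ℚ[ 2 ] :+ t
    Y  = con ℚ[ 3 ] :+ t
    W  = con ℚ[ 4 ] :+ N :+ t
    S  = triangleₚ (Y :+ N) :- triangleₚ Y
    C  = triangleₚ (Y :+ N) :* triangleₚ (Y :+ N) :- triangleₚ Y :* triangleₚ Y

mainTheorem7 : (m : ℕ) → 3 ≤ m →
    (ν (σ m) ≡ 0ℚ)
    × ((t : ℚ) → ν (σ m +ₛ t) ≡ t * (- (ℚ[ 2 ] * ((ℚ[ 2 ] + t) * (ℚ[ 2 ] + t))) - ½ * (t - ℚ[ 1 ]) * (ℚ[ 3 ] + ℚ[ 2 ] * t) * ℚ[ m ] - ½ * (t - ℚ[ 1 ]) * (ℚ[ m ] * ℚ[ m ])))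
    × (5 ≤ m → ν (σ m +ₛ ℚ[ 1 ]) ≡ - ℚ[ 18 ])
mainTheorem7 m@(suc (suc n)) (s≤s (s≤s _)) =
  trans (cong ν (sym (+ₛ-identityʳ (σ m)))) (trans (ν-σ+ₛ n 0ℚ) (closedForm-zero ℚ[ m ])) ,
  ν-σ+ₛ n ,
  λ _ → trans (ν-σ+ₛ n ℚ[ 1 ]) (closedForm-one ℚ[ m ])
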